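{- Let $G$ be a group of order $n$, written additively, and suppose $A_1,\ldots,A_m$ is a partition of $G^*=G\setminus\{0\}$ such that, for $1\le h\le \ell$, there are exactly $c_h$ of the subsets of size $k_h$ (the $k_h$ distinct, $m=\sum_h c_h$). Then $A_1,\ldots,A_m$ is an $(n,m;c_1,\ldots,c_\ell;k_1,\ldots,k_\ell;\lambda_1,\ldots,\lambda_\ell)$-partitioned external difference family if and only if, for each $1\le h\le\ell$, the subsets of cardinality $k_h$ form an $(n,c_h,k_h,c_hk_h-\lambda_h-1,c_hk_h-\lambda_h)$-disjoint partial difference family in $G$.
   Context: For $D\subseteq G$, $\Delta(D)$ is the multiset $\{x-y: x,y\in D,\ x\neq y\}$; for disjoint $D_1,D_2$, $\Delta(D_1,D_2)$ is the multiset $\{x-y:x\in D_1,y\in D_2\}$; $\lambda A$ is the multiset with $\lambda$ copies of each element of $A$. A collection of disjoint subsets $A_1,\dots,A_m$ of $G$, comprising $c_h$ subsets of size $k_h$ ($1\le h\le\ell$), is an $(n,m;c_1,\ldots,c_\ell;k_1,\ldots,k_\ell;\lambda_1,\ldots,\lambda_\ell)$-partitioned external difference family (PEDF) if for each $1\le h\le\ell$ the multiset equation $\bigcup_{i:|A_i|=k_h}\bigcup_{j\neq i}\Delta(A_i,A_j)=\lambda_h G^*$ holds. A collection $\{D_1,\dots,D_c\}$ of disjoint $k$-subsets of $G^*$ with $S=\bigcup_i D_i$ is an $(n,c,k,\lambda,\mu)$-disjoint partial difference family if $\bigcup_{i}\Delta(D_i)=\lambda S+\mu(G^*\setminus S)$.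 -}

module Defs where

open import Level using (0ℓ)
open import Data.Nat using (ℕ; _≡ᵇ_)
open import Data.Bool using (Bool; true; false; if_then_else_; _∧_; not)
open import Data.Fin using (Fin; _≟_)
open import Data.Fin.Subset using (Subset; _∈_; _∉_; ∣_∣)
open import Data.Vec using (lookup)
open import Data.Nat.ListAction using (sum)
open import Data.List using (List; map; allFin; filterᵇ; length)
open import Data.List.Relation.Unary.All using (All)
open import Data.List.Relation.Unary.Any using (Any)
open import Data.List.Relation.Unary.AllPairs using (AllPairs)
open import Data.Integer using (ℤ; +_)
open import Data.Empty using (⊥)
open import Relation.Nullary using (¬_)
open import Relation.Nullary.Decidable using (⌊_⌋)
open import Relation.Binary.PropositionalEquality using (_≡_; _≢_)
open import Algebra.Structures using (IsGroup)

-- A group of order n, written additively, with carrier Fin n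
-- (every group of order n is isomorphic to one of this form).
record FinGroup (n : ℕ) : Set where
  field
    _⊕_     : Fin n → Fin n → Fin n
    zero    : Fin n
    ⊖_      : Fin n → Fin n
    isGroup : IsGroup _≡_ _⊕_ zero ⊖_

  _⊝_ : Fin n → Fin n → Fin n
  x ⊝ y = x ⊕ (⊖ y)

  infixl 6 _⊕_ _⊝_

open FinGroup public

mem : ∀ {n} → Subset n → Fin n → Bool
mem p x = lookup p x

_==_ : ∀ {n} → Fin n → Fin n → Bool
x == y = ⌊ x ≟ y ⌋

[_] : Bool → ℕ
[ true ] = 1
[ false ] = 0

∑ : {A : Set} → List A → (A → ℕ) → ℕ
∑ xs f = sum (map f xs)

Disjoint : ∀ {n} → Subset n → Subset n → Set
Disjoint p q = ∀ x → x ∈ p → x ∈ q → ⊥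

pedfCount : ∀ {n m} → FinGroup n → (Fin m → Subset n) → ℕ → Fin n → ℕ
pedfCount {n} {m} G A k g =
  ∑ (allFin m) λ i → ∑ (allFin m) λ j → ∑ (allFin n) λ x → ∑ (allFin n) λ y →
    [ (∣ A i ∣ ≡ᵇ k) ∧ not (i == j) ∧ mem (A i) x ∧ mem (A j) y ∧ ((_⊝_ G x y) == g) ]

numOfSize : ∀ {n m} → (Fin m → Subset n) → ℕ → ℕ
numOfSize {n} {m} A k = ∑ (allFin m) λ i → [ ∣ A i ∣ ≡ᵇ k ]

record IsPEDF {n m ℓ : ℕ} (G : FinGroup n) (A : Fin m → Subset n)
              (c k lam : Fin ℓ → ℕ) : Set where
  field
    disjoint : ∀ i j → i ≢ j → Disjoint (A i) (A j)
    sizes    : ∀ i → Any (λ h → ∣ A i ∣ ≡ k h) (allFin ℓ)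
    counts   : ∀ h → numOfSize A (k h) ≡ c h
    diffZero : ∀ h → pedfCount G A (k h) (zero G) ≡ 0
    diffNZ   : ∀ h g → g ≢ zero G → pedfCount G A (k h) g ≡ lam h

dpdfCount : ∀ {n} → FinGroup n → List (Subset n) → Fin n → ℕ
dpdfCount {n} G Ds g =
  ∑ Ds λ D → ∑ (allFin n) λ x → ∑ (allFin n) λ y →
    [ mem D x ∧ mem D y ∧ not (x == y) ∧ ((_⊝_ G x y) == g) ]

-- (n, c, k, λ, μ)-disjoint partial difference family in G (λ, μ integers
-- so that no truncated subtraction happens in the parameters)
record IsDPDF {n : ℕ} (G : FinGroup n) (Ds : List (Subset n))
              (c k : ℕ) (lam mu : ℤ) : Set where
  field
    card      : length Ds ≡ c
    sizes     : All (λ D → ∣ D ∣ ≡ k) Ds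
    disjoint  : AllPairs Disjoint Ds
    inGstar   : All (λ D → zero G ∉ D) Ds
    diffZero  : dpdfCount G Ds (zero G) ≡ 0
    diffInS   : ∀ g → g ≢ zero G → Any (λ D → g ∈ D) Ds → + dpdfCount G Ds g ≡ lam
    diffOutS  : ∀ g → g ≢ zero G → ¬ Any (λ D → g ∈ D) Ds → + dpdfCount G Ds g ≡ mu

ofSize : ∀ {n m} → (Fin m → Subset n) → ℕ → List (Subset n)
ofSize {n} {m} A k = map A (filterᵇ (λ i → ∣ A i ∣ ≡ᵇ k) (allFin m))

-- Fix a size class K and g ≠ 0, and count the pairs (i , x) with ∣ A i ∣ = K and x ∈ A i: there are
-- c K of them. The partner y = -g + x of x is the unique y with x - y = g. If y = 0, i.e. x = g, the
-- pair is counted by [g lies in a block of the class]; otherwise y lies in exactly one block A j, and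
-- the pair is an external difference of the class when j ≠ i and an element of Δ(A i) when j = i.
-- Writing #Δ(g) for the multiplicity of g in the union of the Δ(A i) of the class and S for the union
-- of its blocks, this gives
--   λ(g) + #Δ(g) + [g ∈ S] = c K,
-- which for g ∈ S and for g ∉ S turns λ(g) = λ into #Δ(g) = c K - λ - 1 and #Δ(g) = c K - λ. The
-- difference 0 occurs in neither count because distinct blocks are disjoint.

module Submission where

open import Defs
open import Data.Nat using (ℕ; _*_)
open import Data.Integer using (+_; _-_; 1ℤ)
open import Data.Fin using (Fin)
open import Data.Fin.Subset using (Subset; _∈_; _∉_; ∣_∣)
open import Data.Product using (∃; _×_)
open import Relation.Binary.PropositionalEquality using (_≡_; _≢_)
open import Function.Bundles using (_⇔_)

open import Level using (0ℓ)
open import Algebra.Bundles using (Group; AbelianGroup)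
import Algebra.Properties.Group as GroupProperties
open import Data.Bool using (Bool; true; false; T; T?; not; _∧_; if_then_else_)
open import Data.Bool.Properties using (T-≡; T-not-≡; T-∧; ∧-identityʳ)
open import Data.Fin as Fin using (_≟_)
open import Data.Fin.Properties using (suc-injective)
open import Data.Fin.Subset.Properties using (_∈?_)
import Data.Integer as ℤ using (_+_; -_)
import Data.Integer.Properties as ℤ using (+-injective; pos-+; neg-distrib-+; +-assoc; +-0-abelianGroup)
open import Data.List using (List; []; _∷_; map; allFin; filterᵇ; length)
open import Data.List.Properties using (map-∘; map-tabulate; length-map)
open import Data.List.Membership.Propositional using (find; lose)
open import Data.List.Membership.Propositional.Properties using (∈-filter⁺; ∈-filter⁻; ∈-allFin)
open import Data.List.Relation.Unary.All using (All)
import Data.List.Relation.Unary.All as All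
import Data.List.Relation.Unary.All.Properties as All
open import Data.List.Relation.Unary.AllPairs using (AllPairs)
import Data.List.Relation.Unary.AllPairs as AllPairs
import Data.List.Relation.Unary.AllPairs.Properties as AllPairs
open import Data.List.Relation.Unary.Any using (Any; any?)
import Data.List.Relation.Unary.Any.Properties as Any
open import Data.List.Relation.Unary.Unique.Propositional.Properties using (allFin⁺)
open import Data.Nat using (_+_; _≡ᵇ_; suc)
open import Data.Nat.ListAction using (sum)
open import Data.Nat.Properties
  using (+-commutativeSemigroup; +-identityʳ; +-assoc; +-comm; *-distribʳ-+; +-cancelˡ-≡; +-cancelʳ-≡; ≡ᵇ⇒≡)
open import Algebra.Properties.CommutativeSemigroup +-commutativeSemigroup
  using () renaming (interchange to +-interchange)
open import Data.Product using (_,_; proj₁; proj₂)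
open import Data.Vec using (_∷_; [])
open import Data.Vec.Properties using ([]=⇒lookup; lookup⇒[]=)
open import Function using (_∘_; case_of_)
open import Function.Bundles using (mk⇔; Equivalence)
open import Relation.Nullary using (¬_; yes; no; contradiction)
open import Relation.Nullary.Decidable using (toWitness; toWitnessFalse; fromWitness; fromWitnessFalse)
open import Relation.Unary using (Decidable)
open import Relation.Binary.PropositionalEquality
  using (refl; sym; trans; cong; cong₂; subst; module ≡-Reasoning)
open ≡-Reasoning

∑-cong : ∀ {A : Set} (xs : List A) {f g : A → ℕ} → (∀ a → f a ≡ g a) → ∑ xs f ≡ ∑ xs g
∑-cong []       f≗g = refl
∑-cong (x ∷ xs) f≗g = cong₂ _+_ (f≗g x) (∑-cong xs f≗g)

∑-zero : ∀ {A : Set} (xs : List A) {f : A → ℕ} → (∀ a → f a ≡ 0) → ∑ xs f ≡ 0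
∑-zero []       f≗0 = refl
∑-zero (x ∷ xs) f≗0 = cong₂ _+_ (f≗0 x) (∑-zero xs f≗0)

∑-+ : ∀ {A : Set} (xs : List A) (f g : A → ℕ) → ∑ xs (λ a → f a + g a) ≡ ∑ xs f + ∑ xs g
∑-+ []       f g = refl
∑-+ (x ∷ xs) f g =
  trans (cong (λ s → f x + g x + s) (∑-+ xs f g)) (+-interchange (f x) (g x) (∑ xs f) (∑ xs g))

∑-swap : ∀ {A B : Set} (xs : List A) (ys : List B) (f : A → B → ℕ) →
         ∑ xs (λ a → ∑ ys (f a)) ≡ ∑ ys (λ b → ∑ xs (λ a → f a b))
∑-swap []       ys f = sym (∑-zero ys (λ _ → refl))
∑-swap (x ∷ xs) ys f =
  trans (cong (λ s → ∑ ys (f x) + s) (∑-swap xs ys f)) (sym (∑-+ ys (f x) _))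

∑-*ʳ : ∀ {A : Set} (xs : List A) (f : A → ℕ) c → ∑ xs (λ a → f a * c) ≡ ∑ xs f * c
∑-*ʳ []       f c = refl
∑-*ʳ (x ∷ xs) f c =
  trans (cong (λ s → f x * c + s) (∑-*ʳ xs f c)) (sym (*-distribʳ-+ c (f x) (∑ xs f)))

∑-if : ∀ {A : Set} (xs : List A) b (f : A → ℕ) →
       ∑ xs (λ a → if b then f a else 0) ≡ (if b then ∑ xs f else 0)
∑-if xs true  f = refl
∑-if xs false f = ∑-zero xs (λ _ → refl)

∑-map : ∀ {A B : Set} (g : A → B) (xs : List A) (f : B → ℕ) → ∑ (map g xs) f ≡ ∑ xs (f ∘ g)
∑-map g xs f = cong sum (sym (map-∘ xs))

∑-filterᵇ : ∀ {A : Set} (P : A → Bool) (xs : List A) (f : A → ℕ) →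
            ∑ (filterᵇ P xs) f ≡ ∑ xs (λ a → if P a then f a else 0)
∑-filterᵇ P []       f = refl
∑-filterᵇ P (x ∷ xs) f with P x
... | true  = cong (λ s → f x + s) (∑-filterᵇ P xs f)
... | false = ∑-filterᵇ P xs f

length-filterᵇ : ∀ {A : Set} (P : A → Bool) (xs : List A) →
                 length (filterᵇ P xs) ≡ ∑ xs (λ a → [ P a ])
length-filterᵇ P []       = refl
length-filterᵇ P (x ∷ xs) with P x
... | true  = cong suc (length-filterᵇ P xs)
... | false = length-filterᵇ P xs

∑-allFin-suc : ∀ {n} (f : Fin (suc n) → ℕ) →
               ∑ (allFin (suc n)) f ≡ f Fin.zero + ∑ (allFin n) (f ∘ Fin.suc)
∑-allFin-suc f = cong (λ xs → f Fin.zero + sum xs)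
  (trans (map-tabulate Fin.suc f) (sym (map-tabulate (λ i → i) (f ∘ Fin.suc))))

∑-allFin-single : ∀ {n} (f : Fin n → ℕ) i → (∀ j → j ≢ i → f j ≡ 0) → ∑ (allFin n) f ≡ f i
∑-allFin-single {suc n} f Fin.zero f≗0 = begin
  ∑ (allFin (suc n)) f                    ≡⟨ ∑-allFin-suc f ⟩
  f Fin.zero + ∑ (allFin n) (f ∘ Fin.suc) ≡⟨ cong (λ s → f Fin.zero + s) rest ⟩
  f Fin.zero + 0                          ≡⟨ +-identityʳ (f Fin.zero) ⟩
  f Fin.zero                              ∎
  where
  rest : ∑ (allFin n) (f ∘ Fin.suc) ≡ 0
  rest = ∑-zero (allFin n) λ j → f≗0 (Fin.suc j) λ ()
∑-allFin-single {suc n} f (Fin.suc i) f≗0 = begin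
  ∑ (allFin (suc n)) f                    ≡⟨ ∑-allFin-suc f ⟩
  f Fin.zero + ∑ (allFin n) (f ∘ Fin.suc) ≡⟨ cong₂ _+_ (f≗0 Fin.zero λ ()) rest ⟩
  f (Fin.suc i)                           ∎
  where
  rest : ∑ (allFin n) (f ∘ Fin.suc) ≡ f (Fin.suc i)
  rest = ∑-allFin-single (f ∘ Fin.suc) i λ j j≢i → f≗0 (Fin.suc j) (j≢i ∘ suc-injective)

∑-mem : ∀ {n} (p : Subset n) → ∑ (allFin n) (λ x → [ mem p x ]) ≡ ∣ p ∣
∑-mem []          = refl
∑-mem (true ∷ p)  = trans (∑-allFin-suc (λ x → [ mem (true ∷ p) x ])) (cong suc (∑-mem p))
∑-mem (false ∷ p) = trans (∑-allFin-suc (λ x → [ mem (false ∷ p) x ])) (∑-mem p)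

[]-≡0 : ∀ {b} → ¬ T b → [ b ] ≡ 0
[]-≡0 {false} _  = refl
[]-≡0 {true}  ¬t = contradiction _ ¬t

[]-≡1 : ∀ {b} → T b → [ b ] ≡ 1
[]-≡1 {true} _ = refl

[]-cong : ∀ {a b} → T a ⇔ T b → [ a ] ≡ [ b ]
[]-cong {false} {false} _   = refl
[]-cong {false} {true}  a⇔b = contradiction (Equivalence.from a⇔b _) λ ()
[]-cong {true}  {false} a⇔b = contradiction (Equivalence.to a⇔b _) λ ()
[]-cong {true}  {true}  _   = refl

T-mem : ∀ {n} {p : Subset n} {x} → T (mem p x) → x ∈ p
T-mem {p = p} {x} t = lookup⇒[]= x p (Equivalence.to T-≡ t)

∈⇒T-mem : ∀ {n} {p : Subset n} {x} → x ∈ p → T (mem p x)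
∈⇒T-mem x∈p = Equivalence.from T-≡ ([]=⇒lookup x∈p)

T-∧⁻ : ∀ a {b} → T (a ∧ b) → T a × T b
T-∧⁻ a = Equivalence.to (T-∧ {a})

T-== : ∀ {n} {x y : Fin n} → T (x == y) → x ≡ y
T-== = toWitness

T-not-== : ∀ {n} {x y : Fin n} → T (not (x == y)) → x ≢ y
T-not-== = toWitnessFalse

≢⇒==-false : ∀ {n} {x y : Fin n} → x ≢ y → (x == y) ≡ false
≢⇒==-false x≢y = Equivalence.to T-not-≡ (fromWitnessFalse x≢y)

≡⇒==-true : ∀ {n} {x y : Fin n} → x ≡ y → (x == y) ≡ true
≡⇒==-true x≡y = Equivalence.to T-≡ (fromWitness x≡y)

∑-split-at : ∀ {m} i (b : Fin m → Bool) →
             ∑ (allFin m) (λ j → [ not (i == j) ∧ b j ]) + [ b i ] ≡ ∑ (allFin m) (λ j → [ b j ])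
∑-split-at {m} i b = begin
  ∑ (allFin m) (λ j → [ not (i == j) ∧ b j ]) + [ b i ]
    ≡⟨ cong (λ s → ∑ (allFin m) (λ j → [ not (i == j) ∧ b j ]) + s) [b-i]≡ ⟩
  ∑ (allFin m) (λ j → [ not (i == j) ∧ b j ]) + ∑ (allFin m) (λ j → [ (i == j) ∧ b j ])
    ≡⟨ ∑-+ (allFin m) _ _ ⟨
  ∑ (allFin m) (λ j → [ not (i == j) ∧ b j ] + [ (i == j) ∧ b j ])
    ≡⟨ ∑-cong (allFin m) (λ j → split (i == j) (b j)) ⟩
  ∑ (allFin m) (λ j → [ b j ]) ∎
  where
  [b-i]≡ : [ b i ] ≡ ∑ (allFin m) (λ j → [ (i == j) ∧ b j ])
  [b-i]≡ = sym (trans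
    (∑-allFin-single _ i λ j j≢i → []-≡0 λ t → j≢i (sym (T-== (proj₁ (T-∧⁻ (i == j) t)))))
    (cong (λ e → [ e ∧ b i ]) (≡⇒==-true refl)))
  split : ∀ c d → [ not c ∧ d ] + [ c ∧ d ] ≡ [ d ]
  split false d = +-identityʳ [ d ]
  split true  d = refl

occurrences : ∀ {n m} → (Fin m → Subset n) → (Fin m → Bool) → Fin n → ℕ
occurrences {m = m} A b y = ∑ (allFin m) λ i → [ b i ∧ mem (A i) y ]

module _ {n m} (A : Fin m → Subset n) where

  occurrences-≡0 : ∀ b y → (∀ i → T (b i) → y ∉ A i) → occurrences A b y ≡ 0
  occurrences-≡0 b y y∉ = ∑-zero (allFin m) λ i → []-≡0 λ t →
    let bi , y∈ = T-∧⁻ (b i) t in y∉ i bi (T-mem y∈)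

  occurrences-≡1 : (∀ i j → i ≢ j → Disjoint (A i) (A j)) →
                   ∀ b {i y} → T (b i) → y ∈ A i → occurrences A b y ≡ 1
  occurrences-≡1 disj b {i} {y} bi y∈Ai = trans
    (∑-allFin-single _ i λ j j≢i → []-≡0 λ t →
      disj j i j≢i y (T-mem (proj₂ (T-∧⁻ (b j) t))) y∈Ai)
    ([]-≡1 (Equivalence.from T-∧ (bi , ∈⇒T-mem y∈Ai)))

  occurrences-partition : (∀ i j → i ≢ j → Disjoint (A i) (A j)) →
                          ∀ z → (∀ i → z ∉ A i) → (∀ y → y ≢ z → ∃ λ i → y ∈ A i) →
                          ∀ y → occurrences A (λ _ → true) y + [ y == z ] ≡ 1
  occurrences-partition disj z z∉ cover y with y ≟ z
  ... | yes refl = cong (_+ 1) (occurrences-≡0 _ y λ i _ → z∉ i)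
  ... | no y≢z   = cong (_+ 0) (occurrences-≡1 disj _ _ (proj₂ (cover y y≢z)))

asGroup : ∀ {n} → FinGroup n → Group 0ℓ 0ℓ
asGroup {n} G = record
  { Carrier = Fin n ; _≈_ = _≡_ ; _∙_ = _⊕_ G ; ε = zero G ; _⁻¹ = ⊖_ G ; isGroup = isGroup G }

-- In this group x // y = x ∙ y ⁻¹ is definitionally the difference x ⊝ y of Defs, and g \\ x = -g + x
-- is the unique y with x ⊝ y = g.
module Division {n} (G : FinGroup n) where

  open Group (asGroup G) using (_∙_; ε; _//_; _\\_; inverseˡ; inverseʳ; identityʳ)
  open GroupProperties (asGroup G)
    using (\\-leftDividesˡ; \\-leftDividesʳ; //-rightDividesˡ; //-rightDividesʳ; x∙y⁻¹≈ε⇒x≈y)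

  //≡⇒≡\\ : ∀ {x y g} → x // y ≡ g → y ≡ g \\ x
  //≡⇒≡\\ {x} {y} {g} x/y≡g = begin
    y             ≡⟨ \\-leftDividesʳ g y ⟨
    g \\ (g ∙ y)  ≡⟨ cong (λ z → g \\ (z ∙ y)) x/y≡g ⟨
    g \\ ((x // y) ∙ y) ≡⟨ cong (g \\_) (//-rightDividesˡ y x) ⟩
    g \\ x        ∎

  //-\\ : ∀ x g → x // (g \\ x) ≡ g
  //-\\ x g = trans (cong (_// (g \\ x)) (sym (\\-leftDividesˡ g x))) (//-rightDividesʳ (g \\ x) g)

  ≡⇔\\≡ε : ∀ {x g} → x ≡ g ⇔ g \\ x ≡ ε
  ≡⇔\\≡ε {x} {g} = mk⇔ (λ { refl → inverseˡ g }) λ g\\x≡ε → begin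
    x            ≡⟨ \\-leftDividesˡ g x ⟨
    g ∙ (g \\ x) ≡⟨ cong (g ∙_) g\\x≡ε ⟩
    g ∙ ε        ≡⟨ identityʳ g ⟩
    g            ∎

  ≢\\ : ∀ {g} → g ≢ ε → ∀ x → x ≢ g \\ x
  ≢\\ {g} g≢ε x x≡g\\x = g≢ε (begin
    g             ≡⟨ //-\\ x g ⟨
    x // (g \\ x) ≡⟨ cong (x //_) x≡g\\x ⟨
    x // x        ≡⟨ inverseʳ x ⟩
    ε             ∎)

  //≡ε⇒≡ : ∀ {x y} → x // y ≡ ε → x ≡ y
  //≡ε⇒≡ = x∙y⁻¹≈ε⇒x≈y _ _

  ∑-//≡ : ∀ x g (b c : Fin n → Bool) →
          ∑ (allFin n) (λ y → [ b y ∧ c y ∧ ((x // y) == g) ]) ≡ [ b (g \\ x) ∧ c (g \\ x) ]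
  ∑-//≡ x g b c = begin
    ∑ (allFin n) (λ y → [ b y ∧ c y ∧ ((x // y) == g) ])
      ≡⟨ ∑-allFin-single _ (g \\ x) off-partner ⟩
    [ b (g \\ x) ∧ c (g \\ x) ∧ ((x // (g \\ x)) == g) ]
      ≡⟨ cong (λ e → [ b (g \\ x) ∧ c (g \\ x) ∧ e ]) (≡⇒==-true (//-\\ x g)) ⟩
    [ b (g \\ x) ∧ c (g \\ x) ∧ true ]
      ≡⟨ cong (λ z → [ b (g \\ x) ∧ z ]) (∧-identityʳ (c (g \\ x))) ⟩
    [ b (g \\ x) ∧ c (g \\ x) ] ∎
    where
    off-partner : ∀ y → y ≢ g \\ x → [ b y ∧ c y ∧ ((x // y) == g) ] ≡ 0
    off-partner y y≢ = []-≡0 λ t →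
      y≢ (//≡⇒≡\\ (T-== (proj₂ (T-∧⁻ (c y) (proj₂ (T-∧⁻ (b y) t))))))

sizeIs : ∀ {n m} → (Fin m → Subset n) → ℕ → Fin m → Bool
sizeIs A K i = ∣ A i ∣ ≡ᵇ K

module _ {n m} (A : Fin m → Subset n) (K : ℕ) where

  private
    P? : Decidable (T ∘ sizeIs A K)
    P? = T? ∘ sizeIs A K

  ofSize-length : length (ofSize A K) ≡ numOfSize A K
  ofSize-length =
    trans (length-map A (filterᵇ (sizeIs A K) (allFin m))) (length-filterᵇ (sizeIs A K) (allFin m))

  ofSize-All : ∀ {Q : Subset n → Set} → (∀ i → T (sizeIs A K i) → Q (A i)) → All Q (ofSize A K)
  ofSize-All q = All.map⁺ (All.tabulate λ {i} i∈ → q i (proj₂ (∈-filter⁻ P? {xs = allFin m} i∈)))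

  ofSize-disjoint : (∀ i j → i ≢ j → Disjoint (A i) (A j)) → AllPairs Disjoint (ofSize A K)
  ofSize-disjoint disj = AllPairs.map⁺ (AllPairs.filter⁺ P? (AllPairs.map (disj _ _) (allFin⁺ m)))

  ofSize-Any⁻ : ∀ {Q : Subset n → Set} → Any Q (ofSize A K) → ∃ λ i → T (sizeIs A K i) × Q (A i)
  ofSize-Any⁻ q = let i , i∈ , qi = find (Any.map⁻ q) in
    i , proj₂ (∈-filter⁻ P? {xs = allFin m} i∈) , qi

  ofSize-Any⁺ : ∀ {Q : Subset n → Set} i → T (sizeIs A K i) → Q (A i) → Any Q (ofSize A K)
  ofSize-Any⁺ i t qi = Any.map⁺ (lose (∈-filter⁺ P? (∈-allFin i) t) qi)

module _ {n} (G : FinGroup n) where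

  open Group (asGroup G) using (ε)
  open Division G

  pedfCount-ε : ∀ {m} (A : Fin m → Subset n) → (∀ i j → i ≢ j → Disjoint (A i) (A j)) →
                ∀ K → pedfCount G A K ε ≡ 0
  pedfCount-ε {m} A disj K =
    ∑-zero (allFin m) λ i → ∑-zero (allFin m) λ j → ∑-zero (allFin n) λ x → ∑-zero (allFin n) λ y →
    []-≡0 λ t →
      let _    , t₁   = T-∧⁻ (∣ A i ∣ ≡ᵇ K) t
          i≢j  , t₂   = T-∧⁻ (not (i == j)) t₁
          x∈Ai , t₃   = T-∧⁻ (mem (A i) x) t₂
          y∈Aj , x-y≡ε = T-∧⁻ (mem (A j) y) t₃
      in disj i j (T-not-== i≢j) x (T-mem x∈Ai)
           (subst (_∈ A j) (sym (//≡ε⇒≡ (T-== x-y≡ε))) (T-mem y∈Aj))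

  dpdfCount-ε : ∀ Ds → dpdfCount G Ds ε ≡ 0
  dpdfCount-ε Ds = ∑-zero Ds λ D → ∑-zero (allFin n) λ x → ∑-zero (allFin n) λ y → []-≡0 λ t →
    let _ , t₁     = T-∧⁻ (mem D x) t
        _ , t₂     = T-∧⁻ (mem D y) t₁
        x≢y , x-y≡ε = T-∧⁻ (not (x == y)) t₂
    in T-not-== x≢y (//≡ε⇒≡ (T-== x-y≡ε))

module DoubleCounting {n m} (G : FinGroup n) (A : Fin m → Subset n)
  (disj : ∀ i j → i ≢ j → Disjoint (A i) (A j))
  (0∉A : ∀ i → zero G ∉ A i) (cover : ∀ x → x ≢ zero G → ∃ λ i → x ∈ A i)
  (K : ℕ) {g : Fin n} (g≢0 : g ≢ zero G) where

  open Group (asGroup G) using (ε; _//_; _\\_)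
  open Division G

  private
    P : Fin m → Bool
    P = sizeIs A K

  ∑² : (Fin m → Fin n → ℕ) → ℕ
  ∑² F = ∑ (allFin m) λ i → ∑ (allFin n) (F i)

  ∑²-+ : ∀ F H → ∑² (λ i x → F i x + H i x) ≡ ∑² F + ∑² H
  ∑²-+ F H = trans (∑-cong (allFin m) λ i → ∑-+ (allFin n) (F i) (H i)) (∑-+ (allFin m) _ _)

  pedfSlice dpdfSlice zeroSlice : Fin m → Fin n → ℕ
  pedfSlice i x = ∑ (allFin m) λ j → ∑ (allFin n) λ y →
    [ P i ∧ not (i == j) ∧ mem (A i) x ∧ mem (A j) y ∧ ((x // y) == g) ]
  dpdfSlice i x = if P i
    then ∑ (allFin n) (λ y → [ mem (A i) x ∧ mem (A i) y ∧ not (x == y) ∧ ((x // y) == g) ])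
    else 0
  zeroSlice i x = [ P i ∧ mem (A i) x ∧ (x == g) ]

  slices-sum : ∀ i x → pedfSlice i x + dpdfSlice i x + zeroSlice i x ≡ [ P i ∧ mem (A i) x ]
  slices-sum i x with P i | mem (A i) x
  ... | false | _     = cong (λ s → s + 0 + 0) (∑-zero (allFin m) λ _ → ∑-zero (allFin n) λ _ → refl)
  ... | true  | false = cong₂ (λ s t → s + t + 0)
    (∑-zero (allFin m) λ j → ∑-zero (allFin n) λ _ → []-≡0 (proj₂ ∘ T-∧⁻ (not (i == j))))
    (∑-zero (allFin n) λ _ → refl)
  ... | true  | true  = begin
    ∑ (allFin m) (λ j → ∑ (allFin n) λ y → [ not (i == j) ∧ mem (A j) y ∧ ((x // y) == g) ])
      + ∑ (allFin n) (λ y → [ mem (A i) y ∧ not (x == y) ∧ ((x // y) == g) ]) + [ x == g ]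
      ≡⟨ cong₂ (λ s t → s + t + [ x == g ])
           (∑-cong (allFin m) λ j → ∑-//≡ x g (λ _ → not (i == j)) (mem (A j)))
           (∑-//≡ x g (mem (A i)) (λ y → not (x == y))) ⟩
    others + [ mem (A i) y₀ ∧ not (x == y₀) ] + [ x == g ]
      ≡⟨ cong₂ (λ s t → others + s + t) x≢y₀ x≡g⇔y₀≡0 ⟩
    others + [ mem (A i) y₀ ] + [ y₀ == ε ]
      ≡⟨ cong (λ s → s + [ y₀ == ε ]) (∑-split-at i (λ j → mem (A j) y₀)) ⟩
    occurrences A (λ _ → true) y₀ + [ y₀ == ε ]
      ≡⟨ occurrences-partition A disj ε 0∉A cover y₀ ⟩
    1 ∎
    where
    y₀ : Fin n
    y₀ = g \\ x
    others : ℕ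
    others = ∑ (allFin m) (λ j → [ not (i == j) ∧ mem (A j) y₀ ])
    x≢y₀ : [ mem (A i) y₀ ∧ not (x == y₀) ] ≡ [ mem (A i) y₀ ]
    x≢y₀ = trans (cong (λ e → [ mem (A i) y₀ ∧ not e ]) (≢⇒==-false (≢\\ g≢0 x)))
                 (cong [_] (∧-identityʳ (mem (A i) y₀)))
    x≡g⇔y₀≡0 : [ x == g ] ≡ [ y₀ == ε ]
    x≡g⇔y₀≡0 = []-cong (mk⇔ (fromWitness ∘ Equivalence.to ≡⇔\\≡ε ∘ T-==)
                            (fromWitness ∘ Equivalence.from ≡⇔\\≡ε ∘ T-==))

  ∑²-pedfSlice : ∑² pedfSlice ≡ pedfCount G A K g
  ∑²-pedfSlice = ∑-cong (allFin m) λ i → ∑-swap (allFin n) (allFin m) _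

  ∑²-dpdfSlice : ∑² dpdfSlice ≡ dpdfCount G (ofSize A K) g
  ∑²-dpdfSlice = begin
    ∑² dpdfSlice
      ≡⟨ ∑-cong (allFin m) (λ i → ∑-if (allFin n) (P i) _) ⟩
    ∑ (allFin m) (λ i → if P i then Δ-count (A i) else 0)
      ≡⟨ ∑-filterᵇ P (allFin m) (Δ-count ∘ A) ⟨
    ∑ (filterᵇ P (allFin m)) (Δ-count ∘ A)
      ≡⟨ ∑-map A (filterᵇ P (allFin m)) Δ-count ⟨
    dpdfCount G (ofSize A K) g ∎
    where
    Δ-count : Subset n → ℕ
    Δ-count D = ∑ (allFin n) λ x → ∑ (allFin n) λ y →
      [ mem D x ∧ mem D y ∧ not (x == y) ∧ ((x // y) == g) ]

  ∑²-zeroSlice : ∑² zeroSlice ≡ occurrences A P g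
  ∑²-zeroSlice = ∑-cong (allFin m) λ i → begin
    ∑ (allFin n) (zeroSlice i)
      ≡⟨ ∑-allFin-single _ g (λ x x≢g → []-≡0 λ t →
           x≢g (T-== (proj₂ (T-∧⁻ (mem (A i) x) (proj₂ (T-∧⁻ (P i) t)))))) ⟩
    [ P i ∧ mem (A i) g ∧ (g == g) ]
      ≡⟨ cong (λ e → [ P i ∧ mem (A i) g ∧ e ]) (≡⇒==-true refl) ⟩
    [ P i ∧ mem (A i) g ∧ true ]
      ≡⟨ cong (λ e → [ P i ∧ e ]) (∧-identityʳ (mem (A i) g)) ⟩
    [ P i ∧ mem (A i) g ] ∎

  ∑²-members : ∑² (λ i x → [ P i ∧ mem (A i) x ]) ≡ numOfSize A K * K
  ∑²-members = trans (∑-cong (allFin m) members) (∑-*ʳ (allFin m) (λ i → [ P i ]) K)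
    where
    members : ∀ i → ∑ (allFin n) (λ x → [ P i ∧ mem (A i) x ]) ≡ [ P i ] * K
    members i with P i in Pi
    ... | true  =
      trans (∑-mem (A i)) (trans (≡ᵇ⇒≡ _ _ (Equivalence.from T-≡ Pi)) (sym (+-identityʳ K)))
    ... | false = ∑-zero (allFin n) λ _ → refl

  double-count : pedfCount G A K g + dpdfCount G (ofSize A K) g + occurrences A P g ≡ numOfSize A K * K
  double-count = begin
    pedfCount G A K g + dpdfCount G (ofSize A K) g + occurrences A P g
      ≡⟨ cong₂ _+_ (cong₂ _+_ ∑²-pedfSlice ∑²-dpdfSlice) ∑²-zeroSlice ⟨
    ∑² pedfSlice + ∑² dpdfSlice + ∑² zeroSlice
      ≡⟨ cong (λ s → s + ∑² zeroSlice) (∑²-+ pedfSlice dpdfSlice) ⟨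
    ∑² (λ i x → pedfSlice i x + dpdfSlice i x) + ∑² zeroSlice
      ≡⟨ ∑²-+ _ zeroSlice ⟨
    ∑² (λ i x → pedfSlice i x + dpdfSlice i x + zeroSlice i x)
      ≡⟨ ∑-cong (allFin m) (λ i → ∑-cong (allFin n) (slices-sum i)) ⟩
    ∑² (λ i x → [ P i ∧ mem (A i) x ])
      ≡⟨ ∑²-members ⟩
    numOfSize A K * K ∎

m≡o-n⇔m+n≡o : ∀ a b c → (+ a ≡ + c - + b) ⇔ (a + b ≡ c)
m≡o-n⇔m+n≡o a b c = mk⇔
  (λ a≡c-b → ℤ.+-injective (begin
    + (a + b)            ≡⟨ ℤ.pos-+ a b ⟩
    + a ℤ.+ + b          ≡⟨ cong (λ z → z ℤ.+ + b) a≡c-b ⟩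
    (+ c - + b) ℤ.+ + b  ≡⟨ //-rightDividesˡ (+ b) (+ c) ⟩
    + c                  ∎))
  (λ a+b≡c → begin
    + a                  ≡⟨ //-rightDividesʳ (+ b) (+ a) ⟨
    (+ a ℤ.+ + b) - + b  ≡⟨ cong (λ z → z - + b) (ℤ.pos-+ a b) ⟨
    + (a + b) - + b      ≡⟨ cong (λ s → + s - + b) a+b≡c ⟩
    + c - + b            ∎)
  where
  open GroupProperties (AbelianGroup.group ℤ.+-0-abelianGroup) using (//-rightDividesˡ; //-rightDividesʳ)

m-n-1≡m-[n+1] : ∀ c b → + c - + b - 1ℤ ≡ + c - + (b + 1)
m-n-1≡m-[n+1] c b = begin
  + c - + b - 1ℤ             ≡⟨ ℤ.+-assoc (+ c) (ℤ.- + b) (ℤ.- 1ℤ) ⟩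
  + c ℤ.+ (ℤ.- + b - 1ℤ)     ≡⟨ cong (λ z → + c ℤ.+ z) (ℤ.neg-distrib-+ (+ b) 1ℤ) ⟨
  + c - (+ b ℤ.+ 1ℤ)         ≡⟨ cong (λ z → + c - z) (ℤ.pos-+ b 1) ⟨
  + c - + (b + 1)            ∎

summand-⇔ : ∀ {p d e N} → p + d + e ≡ N → ∀ l {r} → r ≡ + N - + (l + e) → (p ≡ l ⇔ + d ≡ r)
summand-⇔ {p} {d} {e} {N} p+d+e≡N l refl = mk⇔
  (λ { refl → Equivalence.from (m≡o-n⇔m+n≡o d (p + e) N) (trans reorder p+d+e≡N) })
  (λ d≡N-l-e → sym (+-cancelʳ-≡ e l p (+-cancelˡ-≡ d (l + e) (p + e)
    (trans (Equivalence.to (m≡o-n⇔m+n≡o d (l + e) N) d≡N-l-e) (trans (sym p+d+e≡N) (sym reorder))))))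
  where
  reorder : d + (p + e) ≡ p + d + e
  reorder = trans (sym (+-assoc d p e)) (cong (_+ e) (+-comm d p))

module SizeClass {n m} (G : FinGroup n) (A : Fin m → Subset n)
  (disj : ∀ i j → i ≢ j → Disjoint (A i) (A j))
  (0∉A : ∀ i → zero G ∉ A i) (cover : ∀ x → x ≢ zero G → ∃ λ i → x ∈ A i)
  (K c l : ℕ) (count : numOfSize A K ≡ c) {g : Fin n} (g≢0 : g ≢ zero G) where

  private
    identity : ∀ {e} → occurrences A (sizeIs A K) g ≡ e →
               pedfCount G A K g + dpdfCount G (ofSize A K) g + e ≡ c * K
    identity refl = trans (DoubleCounting.double-count G A disj 0∉A cover K g≢0) (cong (_* K) count)

  pedf⇔dpdf-∈ : Any (g ∈_) (ofSize A K) →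
    (pedfCount G A K g ≡ l) ⇔ (+ dpdfCount G (ofSize A K) g ≡ + (c * K) - + l - 1ℤ)
  pedf⇔dpdf-∈ g∈S = summand-⇔ (identity occurs-once) l (m-n-1≡m-[n+1] (c * K) l)
    where
    occurs-once : occurrences A (sizeIs A K) g ≡ 1
    occurs-once = let _ , t , g∈Ai = ofSize-Any⁻ A K g∈S in occurrences-≡1 A disj _ t g∈Ai

  pedf⇔dpdf-∉ : ¬ Any (g ∈_) (ofSize A K) →
    (pedfCount G A K g ≡ l) ⇔ (+ dpdfCount G (ofSize A K) g ≡ + (c * K) - + l)
  pedf⇔dpdf-∉ g∉S = summand-⇔ (identity never-occurs) l
    (cong (λ s → + (c * K) - + s) (sym (+-identityʳ l)))
    where
    never-occurs : occurrences A (sizeIs A K) g ≡ 0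
    never-occurs = occurrences-≡0 A _ g λ i t g∈Ai → g∉S (ofSize-Any⁺ A K i t g∈Ai)

theorem2p9 : {n m ℓ : ℕ} (G : FinGroup n) (A : Fin m → Subset n)
    (c k lam : Fin ℓ → ℕ) →
    (∀ h h′ → k h ≡ k h′ → h ≡ h′) →
    (∀ i j → i ≢ j → Disjoint (A i) (A j)) →
    (∀ i → zero G ∉ A i) →
    (∀ x → x ≢ zero G → ∃ λ i → x ∈ A i) →
    (∀ i → ∃ λ h → ∣ A i ∣ ≡ k h) →
    (∀ h → numOfSize A (k h) ≡ c h) →
    IsPEDF G A c k lam ⇔
      (∀ h → IsDPDF G (ofSize A (k h)) (c h) (k h)
               (+ (c h * k h) - + lam h - 1ℤ) (+ (c h * k h) - + lam h))
theorem2p9 {ℓ = ℓ} G A c k lam _ disj 0∉A cover sizes counts = mk⇔ toDPDF toPEDF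
  where
  module Class (h : Fin ℓ) = SizeClass G A disj 0∉A cover (k h) (c h) (lam h) (counts h)
  open Class

  DPDF : Fin ℓ → Set
  DPDF h = IsDPDF G (ofSize A (k h)) (c h) (k h) (+ (c h * k h) - + lam h - 1ℤ) (+ (c h * k h) - + lam h)

  toDPDF : IsPEDF G A c k lam → ∀ h → DPDF h
  toDPDF pedf h = record
    { card     = trans (ofSize-length A (k h)) (counts h)
    ; sizes    = ofSize-All A (k h) λ i → ≡ᵇ⇒≡ _ _
    ; disjoint = ofSize-disjoint A (k h) disj
    ; inGstar  = ofSize-All A (k h) λ i _ → 0∉A i
    ; diffZero = dpdfCount-ε G (ofSize A (k h))
    ; diffInS  = λ g g≢0 g∈S → Equivalence.to (pedf⇔dpdf-∈ h g≢0 g∈S) (IsPEDF.diffNZ pedf h g g≢0)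
    ; diffOutS = λ g g≢0 g∉S → Equivalence.to (pedf⇔dpdf-∉ h g≢0 g∉S) (IsPEDF.diffNZ pedf h g g≢0)
    }

  toPEDF : (∀ h → DPDF h) → IsPEDF G A c k lam
  toPEDF dpdf = record
    { disjoint = disj
    ; sizes    = λ i → lose (∈-allFin (proj₁ (sizes i))) (proj₂ (sizes i))
    ; counts   = counts
    ; diffZero = λ h → pedfCount-ε G A disj (k h)
    ; diffNZ   = λ h g g≢0 → case any? (g ∈?_) (ofSize A (k h)) of λ where
        (yes g∈S) → Equivalence.from (pedf⇔dpdf-∈ h g≢0 g∈S) (IsDPDF.diffInS (dpdf h) g g≢0 g∈S)
        (no g∉S)  → Equivalence.from (pedf⇔dpdf-∉ h g≢0 g∉S) (IsDPDF.diffOutS (dpdf h) g g≢0 g∉S)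
    }
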